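{- (Substitution Principle.) For all formulas $\varphi,\psi,\chi$ and every propositional variable $x$, the formula $(\varphi\equiv\psi)\rightarrow(\chi[x:=\varphi]\equiv\chi[x:=\psi])$ is a theorem of $\mathit{S5BKE}$, where $\varphi\equiv\psi$ abbreviates $\square(\varphi\leftrightarrow\psi)$ and $\chi[x:=\varphi]$ is the result of replacing every occurrence of $x$ in $\chi$ by $\varphi$.
   Context: Language: formulas are built from propositional variables $V=\{x_0,x_1,\dots\}$ with $\neg,\rightarrow$ and unary operators $\square,K,B$; $\wedge,\vee,\leftrightarrow,\top,\bot$ are the usual classical abbreviations. Axioms of $\mathit{S5BKE}$ (all instances of): (i) every formula having the form of a classical propositional tautology; (ii) $K\varphi\rightarrow\varphi$; (iii) $K\varphi\rightarrow B\varphi$; (iv) $\square\varphi\rightarrow\square\square\varphi$; (v) $\neg\square\varphi\rightarrow\square\neg\square\varphi$; (vi) $\square\varphi\rightarrow K\varphi$; (vii) $K(\varphi\rightarrow\psi)\rightarrow(K\varphi\rightarrow K\psi)$; (viii) $B(\varphi\rightarrow\psi)\rightarrow(B\varphi\rightarrow B\psi)$; (ix) $\square(\varphi\rightarrow\psi)\rightarrow(\square\varphi\rightarrow\square\psi)$; (x) $\neg B\bot$. Rules: modus ponens, and axiom necessitation (if $\varphi$ is an axiom, infer $\square\varphi$; applicable only to axioms). A theorem is a formula derivable from the empty set of premises using axioms and these rules. -}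

module Defs where

open import Data.Nat using (ℕ; _≟_)
open import Data.Bool using (Bool; true; false; not; _∨_; if_then_else_)
open import Relation.Nullary.Decidable using (does)
open import Relation.Binary.PropositionalEquality using (_≡_)

data Fm : Set where
  var  : ℕ → Fm
  ¬'_  : Fm → Fm
  _⇒_  : Fm → Fm → Fm
  □_   : Fm → Fm
  K_   : Fm → Fm
  B_   : Fm → Fm

infixr 5 _⇒_
infix 7 ¬'_ □_ K_ B_

_∧'_ : Fm → Fm → Fm
φ ∧' ψ = ¬' (φ ⇒ ¬' ψ)

_⇔_ : Fm → Fm → Fm
φ ⇔ ψ = (φ ⇒ ψ) ∧' (ψ ⇒ φ)

⊤' : Fm
⊤' = var 0 ⇒ var 0

⊥' : Fm
⊥' = ¬' ⊤'

_≣_ : Fm → Fm → Fm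
φ ≣ ψ = □ (φ ⇔ ψ)

_[_≔_] : Fm → ℕ → Fm → Fm
var y [ x ≔ φ ] = if does (y ≟ x) then φ else var y
(¬' χ) [ x ≔ φ ] = ¬' (χ [ x ≔ φ ])
(χ₁ ⇒ χ₂) [ x ≔ φ ] = (χ₁ [ x ≔ φ ]) ⇒ (χ₂ [ x ≔ φ ])
(□ χ) [ x ≔ φ ] = □ (χ [ x ≔ φ ])
(K χ) [ x ≔ φ ] = K (χ [ x ≔ φ ])
(B χ) [ x ≔ φ ] = B (χ [ x ≔ φ ])

-- Classical evaluation treating modal subformulas □ψ, Kψ, Bψ as atoms.
-- A formula has the form of a classical tautology iff it evaluates to true
-- under every assignment to variables and to modal atoms.
eval : (ℕ → Bool) → (Fm → Bool) → Fm → Bool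
eval v m (var x) = v x
eval v m (¬' φ) = not (eval v m φ)
eval v m (φ ⇒ ψ) = not (eval v m φ) ∨ eval v m ψ
eval v m (□ φ) = m (□ φ)
eval v m (K φ) = m (K φ)
eval v m (B φ) = m (B φ)

Tautology : Fm → Set
Tautology φ = ∀ (v : ℕ → Bool) (m : Fm → Bool) → eval v m φ ≡ true

data Axiom : Fm → Set where
  ax-taut : ∀ {φ} → Tautology φ → Axiom φ
  ax-KT   : ∀ φ → Axiom (K φ ⇒ φ)
  ax-KB   : ∀ φ → Axiom (K φ ⇒ B φ)
  ax-4    : ∀ φ → Axiom (□ φ ⇒ □ □ φ)
  ax-5    : ∀ φ → Axiom (¬' □ φ ⇒ □ ¬' □ φ)
  ax-□K   : ∀ φ → Axiom (□ φ ⇒ K φ)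
  ax-distK : ∀ φ ψ → Axiom (K (φ ⇒ ψ) ⇒ (K φ ⇒ K ψ))
  ax-distB : ∀ φ ψ → Axiom (B (φ ⇒ ψ) ⇒ (B φ ⇒ B ψ))
  ax-dist□ : ∀ φ ψ → Axiom (□ (φ ⇒ ψ) ⇒ (□ φ ⇒ □ ψ))
  ax-D    : Axiom (¬' B ⊥')

data ⊢_ : Fm → Set where
  axiom : ∀ {φ} → Axiom φ → ⊢ φ
  mp    : ∀ {φ ψ} → ⊢ (φ ⇒ ψ) → ⊢ φ → ⊢ ψ
  ax-nec : ∀ {φ} → Axiom φ → ⊢ (□ φ)

infix 3 ⊢_

-- The claim is proved by induction on χ, showing for each connective c that c respects ≣:
-- ⊢ (a ≣ b) ⇒ (c a ≣ c b). For ¬' and ⇒ this is the necessitation of a tautology plus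
-- distribution of □. For M ∈ {□, K, B} the axioms give □φ ⇒ Mφ and distribution over ⇒,
-- hence □(a ⇔ b) ⇒ (Ma ⇔ Mb); axiom 4 and distribution of □ then lift this to
-- □(a ⇔ b) ⇒ □(Ma ⇔ Mb). Necessitation, postulated only for axioms, is admissible for
-- all theorems, since □ distributes over modus ponens and axiom 4 handles necessitated axioms.
module Submission where

open import Defs
open import Data.Bool using (Bool; true; false; not; _∨_; T)
open import Data.Bool.Properties using (T-≡)
open import Data.Fin as Fin using (Fin)
open import Data.Nat using (ℕ; zero; suc; _≟_)
open import Data.Product using (_×_; _,_)
open import Data.Vec using (Vec; []; _∷_; lookup; map)
open import Data.Vec.Properties using (lookup-map)
open import Function using (_∘_)
open import Function.Bundles using (Equivalence)
open import Relation.Binary.PropositionalEquality using (_≡_; refl; sym; cong; cong₂; trans)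
open import Relation.Nullary.Decidable using (does)

data Schema (n : ℕ) : Set where
  `_  : Fin n → Schema n
  ~_  : Schema n → Schema n
  _⊃_ : Schema n → Schema n → Schema n

infixr 5 _⊃_
infix 6 _⇔ˢ_
infix 7 ~_

-- Unfolds to exactly the shape of _⇔_ (through _∧'_), so instances match _⇔_ definitionally.
_⇔ˢ_ : ∀ {n} → Schema n → Schema n → Schema n
s ⇔ˢ t = ~ ((s ⊃ t) ⊃ ~ (t ⊃ s))

p₀ : ∀ {n} → Schema (suc n)
p₀ = ` Fin.zero

p₁ : ∀ {n} → Schema (suc (suc n))
p₁ = ` Fin.suc Fin.zero

p₂ : ∀ {n} → Schema (suc (suc (suc n)))
p₂ = ` Fin.suc (Fin.suc Fin.zero)

p₃ : ∀ {n} → Schema (suc (suc (suc (suc n))))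
p₃ = ` Fin.suc (Fin.suc (Fin.suc Fin.zero))

⟦_⟧ : ∀ {n} → Schema n → Vec Bool n → Bool
⟦ ` i ⟧ bs = lookup bs i
⟦ ~ s ⟧ bs = not (⟦ s ⟧ bs)
⟦ s ⊃ t ⟧ bs = not (⟦ s ⟧ bs) ∨ ⟦ t ⟧ bs

_⟨_⟩ : ∀ {n} → Schema n → Vec Fm n → Fm
(` i) ⟨ σ ⟩ = lookup σ i
(~ s) ⟨ σ ⟩ = ¬' (s ⟨ σ ⟩)
(s ⊃ t) ⟨ σ ⟩ = (s ⟨ σ ⟩) ⇒ (t ⟨ σ ⟩)

eval-⟨⟩ : ∀ {n} v m (s : Schema n) (σ : Vec Fm n) → eval v m (s ⟨ σ ⟩) ≡ ⟦ s ⟧ (map (eval v m) σ)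
eval-⟨⟩ v m (` i) σ = sym (lookup-map i (eval v m) σ)
eval-⟨⟩ v m (~ s) σ = cong not (eval-⟨⟩ v m s σ)
eval-⟨⟩ v m (s ⊃ t) σ = cong₂ (λ a b → not a ∨ b) (eval-⟨⟩ v m s σ) (eval-⟨⟩ v m t σ)

-- For a valid concrete schema this normalises to a product of ⊤, so the implicit
-- argument of instance-axiom is solved by eta.
TruthTable : ∀ n → (Vec Bool n → Bool) → Set
TruthTable zero f = T (f [])
TruthTable (suc n) f = TruthTable n (f ∘ (true ∷_)) × TruthTable n (f ∘ (false ∷_))

truthTable-sound : ∀ {n} (f : Vec Bool n → Bool) → TruthTable n f → ∀ bs → f bs ≡ true
truthTable-sound f row [] = Equivalence.to T-≡ row
truthTable-sound f (rows-t , rows-f) (true ∷ bs) = truthTable-sound (f ∘ (true ∷_)) rows-t bs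
truthTable-sound f (rows-t , rows-f) (false ∷ bs) = truthTable-sound (f ∘ (false ∷_)) rows-f bs

instance-axiom : ∀ {n} (s : Schema n) {valid : TruthTable n ⟦ s ⟧} (σ : Vec Fm n) → ⊢ s ⟨ σ ⟩
instance-axiom s {valid} σ =
  axiom (ax-taut λ v m → trans (eval-⟨⟩ v m s σ) (truthTable-sound ⟦ s ⟧ valid (map (eval v m) σ)))

⇒-refl : ∀ {a} → ⊢ a ⇒ a
⇒-refl {a} = instance-axiom (p₀ ⊃ p₀) (a ∷ [])

⇔-refl : ∀ {a} → ⊢ a ⇔ a
⇔-refl {a} = instance-axiom (p₀ ⇔ˢ p₀) (a ∷ [])

weaken : ∀ {a b} → ⊢ a → ⊢ b ⇒ a
weaken {a} {b} = mp (instance-axiom (p₀ ⊃ p₁ ⊃ p₀) (a ∷ b ∷ []))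

infixr 4 _⨾_
_⨾_ : ∀ {a b c} → ⊢ a ⇒ b → ⊢ b ⇒ c → ⊢ a ⇒ c
_⨾_ {a} {b} {c} ab bc = mp (mp (instance-axiom ((p₀ ⊃ p₁) ⊃ (p₁ ⊃ p₂) ⊃ (p₀ ⊃ p₂)) (a ∷ b ∷ c ∷ [])) ab) bc

combine : ∀ {a b c d} → ⊢ a ⇒ b → ⊢ a ⇒ c → ⊢ b ⇒ c ⇒ d → ⊢ a ⇒ d
combine {a} {b} {c} {d} ab ac bcd =
  mp (mp (mp (instance-axiom ((p₀ ⊃ p₁) ⊃ (p₀ ⊃ p₂) ⊃ (p₁ ⊃ p₂ ⊃ p₃) ⊃ (p₀ ⊃ p₃))
                             (a ∷ b ∷ c ∷ d ∷ [])) ab) ac) bcd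

necessitation : ∀ {φ} → ⊢ φ → ⊢ □ φ
necessitation (axiom ax) = ax-nec ax
necessitation (mp d e) = mp (mp (axiom (ax-dist□ _ _)) (necessitation d)) (necessitation e)
necessitation (ax-nec ax) = mp (axiom (ax-4 _)) (ax-nec ax)

□-mono : ∀ {a b} → ⊢ a ⇒ b → ⊢ □ a ⇒ □ b
□-mono d = mp (axiom (ax-dist□ _ _)) (necessitation d)

□-mono₂ : ∀ {a b c} → ⊢ a ⇒ b ⇒ c → ⊢ □ a ⇒ □ b ⇒ □ c
□-mono₂ d = □-mono d ⨾ axiom (ax-dist□ _ _)

¬-resp-≣ : ∀ {a b} → ⊢ (a ≣ b) ⇒ ((¬' a) ≣ (¬' b))
¬-resp-≣ {a} {b} = □-mono (instance-axiom ((p₀ ⇔ˢ p₁) ⊃ (~ p₀ ⇔ˢ ~ p₁)) (a ∷ b ∷ []))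

⇒-resp-≣ : ∀ {a b c d} → ⊢ (a ≣ b) ⇒ (c ≣ d) ⇒ ((a ⇒ c) ≣ (b ⇒ d))
⇒-resp-≣ {a} {b} {c} {d} =
  □-mono₂ (instance-axiom ((p₀ ⇔ˢ p₁) ⊃ (p₂ ⇔ˢ p₃) ⊃ ((p₀ ⊃ p₂) ⇔ˢ (p₁ ⊃ p₃))) (a ∷ b ∷ c ∷ d ∷ []))

module _ (M : Fm → Fm)
         (□⇒M : ∀ φ → ⊢ □ φ ⇒ M φ)
         (M-dist : ∀ φ ψ → ⊢ M (φ ⇒ ψ) ⇒ (M φ ⇒ M ψ)) where

  normal-resp-≣ : ∀ {a b} → ⊢ (a ≣ b) ⇒ (M a ≣ M b)
  normal-resp-≣ {a} {b} = axiom (ax-4 _) ⨾ □-mono (combine forth back ⇔-intro)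
    where
    forth : ⊢ (a ≣ b) ⇒ (M a ⇒ M b)
    forth = □-mono (instance-axiom ((p₀ ⇔ˢ p₁) ⊃ (p₀ ⊃ p₁)) (a ∷ b ∷ [])) ⨾ □⇒M _ ⨾ M-dist _ _

    back : ⊢ (a ≣ b) ⇒ (M b ⇒ M a)
    back = □-mono (instance-axiom ((p₀ ⇔ˢ p₁) ⊃ (p₁ ⊃ p₀)) (a ∷ b ∷ [])) ⨾ □⇒M _ ⨾ M-dist _ _

    ⇔-intro : ⊢ (M a ⇒ M b) ⇒ (M b ⇒ M a) ⇒ (M a ⇔ M b)
    ⇔-intro = instance-axiom ((p₀ ⊃ p₁) ⊃ (p₁ ⊃ p₀) ⊃ (p₀ ⇔ˢ p₁)) (M a ∷ M b ∷ [])

□-resp-≣ : ∀ {a b} → ⊢ (a ≣ b) ⇒ ((□ a) ≣ (□ b))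
□-resp-≣ = normal-resp-≣ □_ (λ _ → ⇒-refl) (λ φ ψ → axiom (ax-dist□ φ ψ))

K-resp-≣ : ∀ {a b} → ⊢ (a ≣ b) ⇒ ((K a) ≣ (K b))
K-resp-≣ = normal-resp-≣ K_ (λ φ → axiom (ax-□K φ)) (λ φ ψ → axiom (ax-distK φ ψ))

B-resp-≣ : ∀ {a b} → ⊢ (a ≣ b) ⇒ ((B a) ≣ (B b))
B-resp-≣ = normal-resp-≣ B_ (λ φ → axiom (ax-□K φ) ⨾ axiom (ax-KB φ)) (λ φ ψ → axiom (ax-distB φ ψ))

theorem3p6 : (φ ψ χ : Fm) (x : ℕ) → ⊢ ((φ ≣ ψ) ⇒ ((χ [ x ≔ φ ]) ≣ (χ [ x ≔ ψ ])))
theorem3p6 φ ψ (var y) x with does (y ≟ x)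
... | true  = ⇒-refl
... | false = weaken (necessitation ⇔-refl)
theorem3p6 φ ψ (¬' χ) x = theorem3p6 φ ψ χ x ⨾ ¬-resp-≣
theorem3p6 φ ψ (χ₁ ⇒ χ₂) x = combine (theorem3p6 φ ψ χ₁ x) (theorem3p6 φ ψ χ₂ x) ⇒-resp-≣
theorem3p6 φ ψ (□ χ) x = theorem3p6 φ ψ χ x ⨾ □-resp-≣
theorem3p6 φ ψ (K χ) x = theorem3p6 φ ψ χ x ⨾ K-resp-≣
theorem3p6 φ ψ (B χ) x = theorem3p6 φ ψ χ x ⨾ B-resp-≣
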